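{- Let $m\geq 4$ be an even integer and let $H_m$ be the graph defined below. Then $\pi^*_2(H_m)=5$ and $\pi^*(H_m)=4$.
   Context: Construction of $H_m$ ($m$ even): take two disjoint complete graphs of order $m$ with vertices $u_1,\dots,u_m$ and $v_1,\dots,v_m$ respectively. Remove the edges $\{u_i,u_{i+1}\}$ and $\{v_i,v_{i+1}\}$ for every odd $i$ (with $1\leq i\leq m-1$). Add a new vertex $w$ adjacent to $u_i$ and $v_i$ for every odd $i$. Add the edges $\{u_i,v_i\}$ for every even $i$. (Thus $H_m$ has $2m+1$ vertices and minimum degree $m-1$.) A pebble distribution on a graph $G$ is a function $D:V(G)\to\mathbb{Z}_{\geq 0}$; its size is $|D|=\sum_v D(v)$. A pebbling move removes two pebbles from a vertex having at least two pebbles and places one pebble on an adjacent vertex. A vertex is reachable under $D$ if some sequence of pebbling moves, each applied to a vertex having at least two pebbles at that time, results in at least one pebble on it. $D$ is solvable if every vertex is reachable. $\pi^*(G)$ is the minimum size of a solvable distribution. A distribution is $2$-restricted if $D(v)\leq 2$ for all $v$; $\pi^*_2(G)$ is the minimum size of a solvable $2$-restricted distribution. -}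

module Defs where

open import Data.Nat using (ℕ; zero; suc; _+_; _≤_; _%_)
open import Data.Fin using (Fin; toℕ)
open import Data.List using (List; _∷_; map; _++_)
open import Data.Nat.ListAction using (sum)
open import Data.List using () renaming (allFin to allFinL)
open import Data.Product using (Σ; _×_; ∃)
open import Data.Sum using (_⊎_)
open import Data.Empty using (⊥)
open import Relation.Nullary using (¬_)
open import Relation.Binary.PropositionalEquality using (_≡_; _≢_)
open import Relation.Binary.Construct.Closure.ReflexiveTransitive using (Star)

Distribution : Set → Set
Distribution V = V → ℕ

-- One pebbling move from D to D': remove two pebbles from x (which has
-- at least two) and add one pebble to a neighbour y; other vertices unchanged.
-- (For loopless graphs, adjacency forces x ≢ y.)
Move : {V : Set} → (V → V → Set) → Distribution V → Distribution V → Set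
Move {V} E D D' =
  Σ V λ x → Σ V λ y →
    E x y × 2 ≤ D x × D' x + 2 ≡ D x × D' y ≡ suc (D y) ×
    ((z : V) → z ≢ x → z ≢ y → D' z ≡ D z)

Moves : {V : Set} → (V → V → Set) → Distribution V → Distribution V → Set
Moves E = Star (Move E)

Reachable : {V : Set} → (V → V → Set) → Distribution V → V → Set
Reachable E D t = ∃ λ D' → Moves E D D' × 1 ≤ D' t

Solvable : {V : Set} → (V → V → Set) → Distribution V → Set
Solvable E D = ∀ t → Reachable E D t

-- size of a distribution, given an enumeration (without repetition) of V
size : {V : Set} → List V → Distribution V → ℕ
size vs D = sum (map D vs)

TwoRestricted : {V : Set} → Distribution V → Set
TwoRestricted D = ∀ x → D x ≤ 2

-- Vertices u_1..u_m, v_1..v_m, w.  The Fin m index k stands for i = k+1.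
data HV (m : ℕ) : Set where
  u : Fin m → HV m
  v : Fin m → HV m
  w : HV m

vertices : (m : ℕ) → List (HV m)
vertices m = w ∷ (map u (allFinL m) ++ map v (allFinL m))

-- index k corresponds to i = k+1; "i odd" iff k is even
OddI : {m : ℕ} → Fin m → Set
OddI k = toℕ k % 2 ≡ 0

EvenI : {m : ℕ} → Fin m → Set
EvenI k = toℕ k % 2 ≡ 1

Removed : {m : ℕ} → Fin m → Fin m → Set
Removed a b = (OddI a × toℕ b ≡ suc (toℕ a)) ⊎ (OddI b × toℕ a ≡ suc (toℕ b))

HAdj : (m : ℕ) → HV m → HV m → Set
HAdj m (u a) (u b) = a ≢ b × ¬ Removed a b
HAdj m (v a) (v b) = a ≢ b × ¬ Removed a b
HAdj m (u a) (v b) = a ≡ b × EvenI a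
HAdj m (v a) (u b) = a ≡ b × EvenI a
HAdj m w (u b) = OddI b
HAdj m w (v b) = OddI b
HAdj m (u a) w = OddI a
HAdj m (v a) w = OddI a
HAdj m w w = ⊥

OptPebblingIs : ℕ → ℕ → Set
OptPebblingIs m k =
  (Σ (Distribution (HV m)) λ D → Solvable (HAdj m) D × size (vertices m) D ≡ k) ×
  ((D : Distribution (HV m)) → Solvable (HAdj m) D → k ≤ size (vertices m) D)

OptPebbling2Is : ℕ → ℕ → Set
OptPebbling2Is m k =
  (Σ (Distribution (HV m)) λ D →
     TwoRestricted D × Solvable (HAdj m) D × size (vertices m) D ≡ k) ×
  ((D : Distribution (HV m)) → TwoRestricted D → Solvable (HAdj m) D →
     k ≤ size (vertices m) D)

{-# OPTIONS --safe #-}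
module Submission where

-- Upper bounds: four pebbles on w reach every vertex (u_i, v_i with i odd directly, the others
-- through a vertex with odd index in another block), and two pebbles on each of u_1, v_1 plus one
-- on w is a solvable 2-restricted distribution.
--
-- Lower bounds: a distribution of size at most 3, or a 2-restricted one of size at most 4, either
-- has at most one pebble per vertex (then no move is possible and, having fewer pebbles than H_m
-- has vertices, it leaves some vertex empty) or consists of a pile x, x plus at most two further
-- pebbles. For each such configuration a target t is exhibited that satisfies a local
-- non-adjacency condition; such a t is "safe": it is empty, and every move leads to a
-- configuration dominated by one in which t is again safe.
--
-- The existence of these targets in H_m is a first-order property of the graph. The truth of an
-- atomic statement about vertices p, q depends only on their kinds (w, or u_i or v_i with i odd
-- or even) and on whether they lie in the same block {i, i+1}, i odd. Quantifiers are evaluated on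
-- these finite profiles; an existential witness is looked for at w, or with a given kind in the
-- block of a vertex in scope, or in a block different from it (there are two blocks as m ≥ 4).
-- Evaluating a formula on profiles is a finite boolean computation, proved sound for every m.

open import Defs
open import Algebra.Properties.CommutativeSemigroup using (interchange)
open import Data.Bool using (Bool; true; false; not; _∧_; _∨_; _xor_; T; if_then_else_)
open import Data.Bool.ListAction using (all; any)
open import Data.Bool.Properties using (T-∧; T-∨; T-≡)
open import Data.Empty using (⊥-elim)
open import Data.Fin using (Fin; toℕ; fromℕ<; #_) renaming (zero to fzero; suc to fsuc)
import Data.Fin as Fin
open import Data.Fin.Properties using (toℕ-injective; toℕ-fromℕ<; toℕ<n)
open import Data.List using (List; []; _∷_; _++_; length; replicate; concatMap; allFin)
import Data.List as List
open import Data.List.Membership.Propositional using (_∈_)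
open import Data.List.Membership.Propositional.Properties
  using (∈-∃++; ∈-++⁺ˡ; ∈-++⁺ʳ; ∈-map⁺; ∈-map⁻; ∈-allFin)
open import Data.List.Properties using (length-++; length-replicate)
open import Data.List.Relation.Binary.Permutation.Propositional as ↭ using (_↭_; prep; swap)
open import Data.List.Relation.Binary.Permutation.Propositional.Properties using (shift; ↭-length; ++-comm)
open import Data.List.Relation.Unary.All as All using (All; []; _∷_)
import Data.List.Relation.Unary.All.Properties as All
open import Data.List.Relation.Unary.AllPairs using ([]; _∷_)
open import Data.List.Relation.Unary.Any using (here; there; satisfied)
open import Data.List.Relation.Unary.Any.Properties using (any⁻)
open import Data.List.Relation.Unary.Unique.Propositional using (Unique)
import Data.List.Relation.Unary.Unique.Propositional.Properties as Unique
open import Data.Nat using (ℕ; zero; suc; _+_; _*_; _∸_; _≤_; _<_; z≤n; s≤s; _≤?_; _%_; _≡ᵇ_; ⌊_/2⌋)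
open import Data.Nat.Properties
  using ( ≤-reflexive; ≤-refl; ≤-trans; ≤-pred; <⇒≱; ≰⇒>; ≮⇒≥; n≤0⇒n≡0; 1+n≰n; m≤n+m; n≤1+n
        ; +-comm; +-cancelʳ-≤; +-cancelˡ-≤; m∸n+n≡m; *-zeroʳ; *-suc; *-identityʳ; +-commutativeSemigroup
        ; suc-injective; ≡ᵇ⇒≡; ≡⇒≡ᵇ)
open import Data.Product using (Σ; ∃; ∃₂; _×_; _,_; proj₁; proj₂)
open import Data.Sum using (_⊎_; inj₁; inj₂)
open import Data.Vec as Vec using (Vec; []; _∷_; lookup)
open import Data.Vec.Properties using (lookup-map)
open import Function using (_∘_; Equivalence)
open import Relation.Binary.Construct.Closure.ReflexiveTransitive using (ε; _◅_)
open import Relation.Binary.Definitions using (DecidableEquality)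
open import Relation.Binary.PropositionalEquality
open import Relation.Nullary using (¬_; yes; no; does; contradiction)

module Pebbling {V : Set} (_≟_ : DecidableEquality V) (E : V → V → Set) (E-irrefl : ∀ {x} → ¬ E x x) where

  private variable
    t x y z a b q : V
    D D' D₁ D₁' D₂ D₂' : Distribution V
    L L' R : List V

  adjacent⇒≢ : E x y → y ≢ x
  adjacent⇒≢ xy refl = E-irrefl xy

  count : V → List V → ℕ
  count q [] = 0
  count q (p ∷ ps) = (if does (p ≟ q) then 1 else 0) + count q ps

  count-here : ∀ q L → count q (q ∷ L) ≡ suc (count q L)
  count-here q L with q ≟ q
  ... | yes _  = refl
  ... | no q≢q = contradiction refl q≢q

  count-there : ∀ p q L → p ≢ q → count q (p ∷ L) ≡ count q L
  count-there p q L p≢q with p ≟ q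
  ... | yes p≡q = contradiction p≡q p≢q
  ... | no _    = refl

  count-pile : ∀ x R → count x (x ∷ x ∷ R) ≡ 2 + count x R
  count-pile x R = trans (count-here x (x ∷ R)) (cong suc (count-here x R))

  count-↭ : L ↭ L' → count q L ≡ count q L'
  count-↭ ↭.refl = refl
  count-↭ {q = q} (prep p L↭L') with p ≟ q
  ... | yes _ = cong suc (count-↭ L↭L')
  ... | no _  = count-↭ L↭L'
  count-↭ {q = q} (swap p r L↭L') with does (p ≟ q) | does (r ≟ q)
  ... | true  | true  = cong (suc ∘ suc) (count-↭ L↭L')
  ... | true  | false = cong suc (count-↭ L↭L')
  ... | false | true  = cong suc (count-↭ L↭L')
  ... | false | false = count-↭ L↭L'
  count-↭ (↭.trans L↭L' L'↭L'') = trans (count-↭ L↭L') (count-↭ L'↭L'')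

  count-absent : All (q ≢_) L → count q L ≡ 0
  count-absent [] = refl
  count-absent {q} {_ ∷ L} (q≢p ∷ q∉L) = trans (count-there _ q L (q≢p ∘ sym)) (count-absent q∉L)

  count≡0⇒∉ : ∀ L → count q L ≡ 0 → All (_≢ q) L
  count≡0⇒∉ [] _ = []
  count≡0⇒∉ {q} (p ∷ L) absent with p ≟ q
  ... | yes _   = contradiction absent λ ()
  ... | no p≢q  = p≢q ∷ count≡0⇒∉ L absent

  count-unique : Unique L → count q L ≤ 1
  count-unique [] = z≤n
  count-unique {p ∷ L} {q} (p∉L ∷ unique) with p ≟ q
  ... | yes refl = s≤s (≤-reflexive (count-absent p∉L))
  ... | no _     = count-unique unique

  count-unique-∈ : Unique L → q ∈ L → count q L ≡ 1
  count-unique-∈ {p ∷ L} (p∉L ∷ _) (here refl) = trans (count-here p L) (cong suc (count-absent p∉L))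
  count-unique-∈ {p ∷ L} {q} (p∉L ∷ unique) (there q∈L) =
    trans (count-there p q L (All.lookup p∉L q∈L)) (count-unique-∈ unique q∈L)

  count≥1⇒∈ : 1 ≤ count q L → q ∈ L
  count≥1⇒∈ {q} {p ∷ L} occupied with p ≟ q
  ... | yes refl = here refl
  ... | no _     = there (count≥1⇒∈ occupied)

  extract : 1 ≤ count q L → ∃ λ R → L ↭ q ∷ R
  extract {q} {L} occupied with ∈-∃++ (count≥1⇒∈ {q} {L} occupied)
  ... | xs , ys , refl = xs ++ ys , shift q xs ys

  extract-pile : 2 ≤ count q L → ∃ λ R → L ↭ q ∷ q ∷ R
  extract-pile {q} {L} two with extract {q} {L} (≤-trans (s≤s z≤n) two)
  ... | L' , L↭qL' with extract {q} {L'} (≤-pred (subst (2 ≤_) (trans (count-↭ L↭qL') (count-here q L')) two))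
  ...   | R , L'↭qR = R , ↭.trans L↭qL' (prep q L'↭qR)

  ⟨_⟩ : List V → Distribution V
  ⟨ L ⟩ q = count q L

  _≤ᴰ_ : Distribution V → Distribution V → Set
  D ≤ᴰ D' = ∀ q → D q ≤ D' q

  ↭⇒≤ᴰ : L ↭ L' → ⟨ L ⟩ ≤ᴰ ⟨ L' ⟩
  ↭⇒≤ᴰ L↭L' q = ≤-reflexive (count-↭ L↭L')

  ≤ᴰ-∷ : ∀ p L → ⟨ L ⟩ ≤ᴰ ⟨ p ∷ L ⟩
  ≤ᴰ-∷ p L q = m≤n+m (count q L) _

  Shifts : Distribution V → V → V → Distribution V → Set
  Shifts D x y D' = D' x + 2 ≡ D x × D' y ≡ suc (D y) × (∀ z → z ≢ x → z ≢ y → D' z ≡ D z)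

  shifts-≤ᴰ : y ≢ x → D₁ ≤ᴰ D₂ → Shifts D₁ x y D₁' → Shifts D₂ x y D₂' → D₁' ≤ᴰ D₂'
  shifts-≤ᴰ {y} {x} {D₁} {D₂} {D₁'} {D₂'} y≢x D₁≤D₂ (from₁ , to₁ , rest₁) (from₂ , to₂ , rest₂) q
      with q ≟ x | q ≟ y
  ... | yes refl | _ = +-cancelʳ-≤ 2 (D₁' q) (D₂' q) (subst₂ _≤_ (sym from₁) (sym from₂) (D₁≤D₂ q))
  ... | no _ | yes refl = subst₂ _≤_ (sym to₁) (sym to₂) (s≤s (D₁≤D₂ q))
  ... | no q≢x | no q≢y = subst₂ _≤_ (sym (rest₁ q q≢x q≢y)) (sym (rest₂ q q≢x q≢y)) (D₁≤D₂ q)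

  shifts-pile : ∀ R → y ≢ x → Shifts ⟨ x ∷ x ∷ R ⟩ x y ⟨ y ∷ R ⟩
  shifts-pile {y} {x} R y≢x =
    trans (cong (_+ 2) (count-there y x R y≢x)) (trans (+-comm (count x R) 2) (sym (count-pile x R))) ,
    trans (count-here y R) (cong suc (sym (trans (count-there x y (x ∷ R) x≢y) (count-there x y R x≢y)))) ,
    λ z z≢x z≢y → trans (count-there y z R (z≢y ∘ sym))
                        (sym (trans (count-there x z (x ∷ R) (z≢x ∘ sym)) (count-there x z R (z≢x ∘ sym))))
    where x≢y = y≢x ∘ sym

  moved-from-pile : ∀ R → D ≤ᴰ ⟨ x ∷ x ∷ R ⟩ → E x y → Shifts D x y D' → D' ≤ᴰ ⟨ y ∷ R ⟩
  moved-from-pile R D≤pile xy shifts = shifts-≤ᴰ (adjacent⇒≢ xy) D≤pile shifts (shifts-pile R (adjacent⇒≢ xy))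

  _[_↝_] : Distribution V → V → V → Distribution V
  (D [ x ↝ y ]) z with z ≟ x | z ≟ y
  ... | yes _ | _     = D x ∸ 2
  ... | no _  | yes _ = suc (D y)
  ... | no _  | no _  = D z

  shifts-↝ : y ≢ x → 2 ≤ D x → Shifts D x y (D [ x ↝ y ])
  shifts-↝ {y} {x} {D} y≢x 2≤Dx = at-x , at-y , elsewhere
    where
    at-x : (D [ x ↝ y ]) x + 2 ≡ D x
    at-x with x ≟ x
    ... | yes _  = m∸n+n≡m 2≤Dx
    ... | no x≢x = contradiction refl x≢x
    at-y : (D [ x ↝ y ]) y ≡ suc (D y)
    at-y with y ≟ x | y ≟ y
    ... | yes y≡x | _     = contradiction y≡x y≢x
    ... | no _ | yes _    = refl
    ... | no _ | no y≢y   = contradiction refl y≢y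
    elsewhere : ∀ z → z ≢ x → z ≢ y → (D [ x ↝ y ]) z ≡ D z
    elsewhere z z≢x z≢y with z ≟ x | z ≟ y
    ... | yes z≡x | _     = contradiction z≡x z≢x
    ... | no _ | yes z≡y  = contradiction z≡y z≢y
    ... | no _ | no _     = refl

  move : E x y → 2 ≤ D x → Move E D (D [ x ↝ y ])
  move {x} {y} xy 2≤Dx = x , y , xy , 2≤Dx , shifts-↝ (adjacent⇒≢ xy) 2≤Dx

  reach-occupied : 1 ≤ D t → Reachable E D t
  reach-occupied occupied = _ , ε , occupied

  reach-adjacent : E x t → 2 ≤ D x → Reachable E D t
  reach-adjacent xt 2≤Dx =
    _ , move xt 2≤Dx ◅ ε , subst (1 ≤_) (sym (proj₁ (proj₂ (shifts-↝ (adjacent⇒≢ xt) 2≤Dx)))) (s≤s z≤n)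

  reach-distance-2 : 4 ≤ D x → E x z → E z t → Reachable E D t
  reach-distance-2 {D} {x} {z} {t} 4≤Dx xz zt =
    _ , move xz 2≤Dx ◅ move xz 2≤once ◅ move zt 2≤twice ◅ ε ,
    subst (1 ≤_) (sym (proj₁ (proj₂ third))) (s≤s z≤n)
    where
    2≤Dx : 2 ≤ D x
    2≤Dx = ≤-trans (s≤s (s≤s z≤n)) 4≤Dx
    first = shifts-↝ (adjacent⇒≢ xz) 2≤Dx
    2≤once : 2 ≤ (D [ x ↝ z ]) x
    2≤once = +-cancelʳ-≤ 2 2 _ (subst (4 ≤_) (sym (proj₁ first)) 4≤Dx)
    second = shifts-↝ (adjacent⇒≢ xz) 2≤once
    2≤twice : 2 ≤ ((D [ x ↝ z ]) [ x ↝ z ]) z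
    2≤twice = subst (2 ≤_) (sym (trans (proj₁ (proj₂ second)) (cong suc (proj₁ (proj₂ first)))))
                    (s≤s (s≤s z≤n))
    third = shifts-↝ (adjacent⇒≢ zt) 2≤twice

  data Safe (t : V) (D : Distribution V) : Set where
    safe : D t ≡ 0 → (∀ {D'} → Move E D D' → Safe t D') → Safe t D

  Safe⇒¬Reachable : Safe t D → ¬ Reachable E D t
  Safe⇒¬Reachable s (_ , moves , occupied) = 1+n≰n (subst (1 ≤_) (empty-after s moves) occupied)
    where
    empty-after : Safe t D → Moves E D D' → D' t ≡ 0
    empty-after (safe empty _) ε = empty
    empty-after (safe _ next) (m ◅ ms) = empty-after (next m) ms

  Safe⇒¬Solvable : Safe t D → ¬ Solvable E D
  Safe⇒¬Solvable s solvable = Safe⇒¬Reachable s (solvable _)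

  -- A move from D′ is simulated by the same move from D.
  Safe-≤ᴰ : D' ≤ᴰ D → Safe t D → Safe t D'
  Safe-≤ᴰ {D'} {D} {t} D'≤D (safe empty next) =
    safe (n≤0⇒n≡0 (subst (D' t ≤_) empty (D'≤D t)))
         λ { (x , y , xy , 2≤D'x , shifts) →
               let 2≤Dx = ≤-trans 2≤D'x (D'≤D x) in
               Safe-≤ᴰ (shifts-≤ᴰ (adjacent⇒≢ xy) D'≤D shifts (shifts-↝ (adjacent⇒≢ xy) 2≤Dx))
                       (next (move xy 2≤Dx)) }

  safe-frozen : D t ≡ 0 → (∀ q → D q ≤ 1) → Safe t D
  safe-frozen empty D≤1 = safe empty λ { (x , _ , _ , 2≤Dx , _) → contradiction (≤-trans 2≤Dx (D≤1 x)) 1+n≰n }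

  safe-scattered : Unique L → All (t ≢_) L → Safe t ⟨ L ⟩
  safe-scattered unique t∉L = safe-frozen (count-absent t∉L) (λ _ → count-unique unique)

  safe-pile : ∀ R → t ≢ x → count t R ≡ 0 → (∀ q → count q R ≤ 1) →
              (∀ {y} → E x y → Safe t ⟨ y ∷ R ⟩) → Safe t ⟨ x ∷ x ∷ R ⟩
  safe-pile {t} {x} R t≢x t∉R R≤1 next =
    safe (trans (count-there x t (x ∷ R) x≢t) (trans (count-there x t R x≢t) t∉R)) after
    where
    x≢t = t≢x ∘ sym
    after : Move E ⟨ x ∷ x ∷ R ⟩ D' → Safe t D'
    after (x' , y , x'y , 2≤ , shifts) with x' ≟ x
    ... | yes refl = Safe-≤ᴰ (moved-from-pile R (λ _ → ≤-refl) x'y shifts) (next x'y)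
    ... | no x'≢x  = contradiction (subst (2 ≤_) (trans (count-there x x' (x ∷ R) (x'≢x ∘ sym))
                                                        (count-there x x' R (x'≢x ∘ sym))) 2≤)
                                   (<⇒≱ (s≤s (R≤1 x')))

  -- OutOfReach-c t …: t is safe for the configuration c of pebbles, see safe-c below.
  OutOfReach-xxx : V → V → Set
  OutOfReach-xxx t x = t ≢ x × ¬ E x t

  OutOfReach-xxa : V → V → V → Set
  OutOfReach-xxa t x a = t ≢ x × t ≢ a × ¬ E x t × (E x a → ¬ E a t)

  OutOfReach-xxab : V → V → V → V → Set
  OutOfReach-xxab t x a b =
    t ≢ x × t ≢ a × t ≢ b × ¬ E x t ×
    (E x a → ¬ E a t × (E a b → ¬ E b t)) × (E x b → ¬ E b t × (E b a → ¬ E a t))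

  OutOfReach-xxyy : V → V → V → Set
  OutOfReach-xxyy t x y = t ≢ x × t ≢ y × ¬ E x t × ¬ E y t × (∀ z → E x z → E y z → ¬ E z t)

  ≢-of-nonadjacent : E x y → ¬ E x t → t ≢ y
  ≢-of-nonadjacent xy x↛t refl = x↛t xy

  safe-xxx : OutOfReach-xxx t x → Safe t ⟨ x ∷ x ∷ x ∷ [] ⟩
  safe-xxx {x = x} (t≢x , x↛t) =
    safe-pile (x ∷ []) t≢x (count-absent (t≢x ∷ [])) (λ _ → count-unique ([] ∷ []))
      λ xy → safe-scattered ((adjacent⇒≢ xy ∷ []) ∷ [] ∷ []) (≢-of-nonadjacent xy x↛t ∷ t≢x ∷ [])

  safe-xx : OutOfReach-xxx t x → Safe t ⟨ x ∷ x ∷ [] ⟩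
  safe-xx {x = x} far = Safe-≤ᴰ (≤ᴰ-∷ x (x ∷ x ∷ [])) (safe-xxx far)

  safe-xxa : a ≢ x → OutOfReach-xxa t x a → Safe t ⟨ x ∷ x ∷ a ∷ [] ⟩
  safe-xxa {a} {x} {t} a≢x (t≢x , t≢a , x↛t , a↛t) =
    safe-pile (a ∷ []) t≢x (count-absent (t≢a ∷ [])) (λ _ → count-unique ([] ∷ [])) next
    where
    next : E x y → Safe t ⟨ y ∷ a ∷ [] ⟩
    next {y} xy with y ≟ a
    ... | yes refl = safe-xx (t≢a , a↛t xy)
    ... | no y≢a   = safe-scattered ((y≢a ∷ []) ∷ [] ∷ []) (≢-of-nonadjacent xy x↛t ∷ t≢a ∷ [])

  safe-xxab : a ≢ x → b ≢ x → b ≢ a → OutOfReach-xxab t x a b → Safe t ⟨ x ∷ x ∷ a ∷ b ∷ [] ⟩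
  safe-xxab {a} {x} {b} {t} a≢x b≢x b≢a (t≢x , t≢a , t≢b , x↛t , via-a , via-b) =
    safe-pile (a ∷ b ∷ []) t≢x (count-absent (t≢a ∷ t≢b ∷ []))
              (λ _ → count-unique ((a≢b ∷ []) ∷ [] ∷ [])) next
    where
    a≢b = b≢a ∘ sym
    next : E x y → Safe t ⟨ y ∷ a ∷ b ∷ [] ⟩
    next {y} xy with y ≟ a | y ≟ b
    ... | yes refl | _ = safe-xxa b≢a (t≢a , t≢b , via-a xy)
    ... | no _ | yes refl =
      Safe-≤ᴰ (↭⇒≤ᴰ (prep b (++-comm (a ∷ []) (b ∷ [])))) (safe-xxa a≢b (t≢b , t≢a , via-b xy))
    ... | no y≢a | no y≢b =
      safe-scattered ((y≢a ∷ y≢b ∷ []) ∷ (a≢b ∷ []) ∷ [] ∷ [])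
                     (≢-of-nonadjacent xy x↛t ∷ t≢a ∷ t≢b ∷ [])

  safe-xxyy : y ≢ x → OutOfReach-xxyy t x y → Safe t ⟨ x ∷ x ∷ y ∷ y ∷ [] ⟩
  safe-xxyy {y} {x} {t} y≢x (t≢x , t≢y , x↛t , y↛t , common) =
    safe (count-absent (t≢x ∷ t≢x ∷ t≢y ∷ t≢y ∷ [])) after
    where
    after-pile : ∀ {p r} → t ≢ r → ¬ E p t → ¬ E r t → (∀ z → E p z → E r z → ¬ E z t) →
                 E p z → Safe t ⟨ z ∷ r ∷ r ∷ [] ⟩
    after-pile {z} {p} {r} t≢r p↛t r↛t common' pz with z ≟ r
    ... | yes refl = safe-xxx (t≢r , r↛t)
    ... | no z≢r   = Safe-≤ᴰ (↭⇒≤ᴰ (++-comm (z ∷ []) (r ∷ r ∷ [])))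
                             (safe-xxa z≢r (t≢r , ≢-of-nonadjacent pz p↛t , r↛t , common' z pz))
    after : Move E ⟨ x ∷ x ∷ y ∷ y ∷ [] ⟩ D' → Safe t D'
    after (s , z , sz , 2≤ , shifts) with s ≟ x | s ≟ y
    ... | yes refl | _ =
      Safe-≤ᴰ (moved-from-pile (y ∷ y ∷ []) (λ _ → ≤-refl) sz shifts) (after-pile t≢y x↛t y↛t common sz)
    ... | no _ | yes refl =
      Safe-≤ᴰ (moved-from-pile (x ∷ x ∷ []) (↭⇒≤ᴰ (++-comm (x ∷ x ∷ []) (y ∷ y ∷ []))) sz shifts)
              (after-pile t≢x y↛t x↛t (λ z yz xz → common z xz yz) sz)
    ... | no s≢x | no s≢y =
      contradiction (subst (2 ≤_) (count-absent (s≢x ∷ s≢x ∷ s≢y ∷ s≢y ∷ [])) 2≤) λ ()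

  unoccupied : ∀ vs → size vs D < length vs → ∃ λ t → D t ≡ 0
  unoccupied {D} (p ∷ ps) small with D p in Dp
  ... | zero  = p , Dp
  ... | suc n = unoccupied ps (≤-trans (s≤s (m≤n+m _ n)) (≤-pred small))

  module Enumerated (vs : List V) (vs-unique : Unique vs) (vs-complete : ∀ q → q ∈ vs) where

    pebbles : Distribution V → List V → List V
    pebbles D [] = []
    pebbles D (p ∷ ps) = replicate (D p) p ++ pebbles D ps

    count-replicate-++ : ∀ k p q L → count q (replicate k p ++ L) ≡ (if does (p ≟ q) then k else 0) + count q L
    count-replicate-++ zero p q L with p ≟ q
    ... | yes _ = refl
    ... | no _  = refl
    count-replicate-++ (suc k) p q L with p ≟ q | count-replicate-++ k p q L
    ... | yes _ | split = cong suc split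
    ... | no _  | split = split

    count-pebbles : ∀ ps → count q (pebbles D ps) ≡ D q * count q ps
    count-pebbles {q} {D} [] = sym (*-zeroʳ (D q))
    count-pebbles {q} {D} (p ∷ ps) with p ≟ q | count-replicate-++ (D p) p q (pebbles D ps)
    ... | yes refl | split = trans split (trans (cong (D p +_) (count-pebbles ps)) (sym (*-suc (D p) _)))
    ... | no _     | split = trans split (count-pebbles ps)

    ⟨pebbles⟩ : ⟨ pebbles D vs ⟩ ≗ D
    ⟨pebbles⟩ {D} q =
      trans (count-pebbles vs) (trans (cong (D q *_) (count-unique-∈ vs-unique (vs-complete q))) (*-identityʳ (D q)))

    length-pebbles : ∀ ps → length (pebbles D ps) ≡ size ps D
    length-pebbles [] = refl
    length-pebbles {D} (p ∷ ps) =
      trans (length-++ (replicate (D p) p)) (cong₂ _+_ (length-replicate (D p)) (length-pebbles ps))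

    size-+ : ∀ ps (f g : Distribution V) → size ps (λ q → f q + g q) ≡ size ps f + size ps g
    size-+ [] f g = refl
    size-+ (p ∷ ps) f g =
      trans (cong (f p + g p +_) (size-+ ps f g)) (interchange +-commutativeSemigroup (f p) (g p) (size ps f) (size ps g))

    size-indicator : ∀ p ps → size ps (λ q → if does (p ≟ q) then 1 else 0) ≡ count p ps
    size-indicator p [] = refl
    size-indicator p (r ∷ ps) with p ≟ r | r ≟ p
    ... | yes _   | yes _   = cong suc (size-indicator p ps)
    ... | no _    | no _    = size-indicator p ps
    ... | yes p≡r | no r≢p  = contradiction (sym p≡r) r≢p
    ... | no p≢r  | yes r≡p = contradiction (sym r≡p) p≢r

    size-⟨⟩ : ∀ L → size vs ⟨ L ⟩ ≡ length L
    size-⟨⟩ [] = size-zero vs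
      where
      size-zero : ∀ ps → size ps ⟨ [] ⟩ ≡ 0
      size-zero [] = refl
      size-zero (_ ∷ ps) = size-zero ps
    size-⟨⟩ (p ∷ L) = begin
      size vs ⟨ p ∷ L ⟩
        ≡⟨ size-+ vs _ ⟨ L ⟩ ⟩
      size vs (λ q → if does (p ≟ q) then 1 else 0) + size vs ⟨ L ⟩
        ≡⟨ cong₂ _+_ (size-indicator p vs) (size-⟨⟩ L) ⟩
      count p vs + length L
        ≡⟨ cong (_+ length L) (count-unique-∈ vs-unique (vs-complete p)) ⟩
      suc (length L)
        ∎
      where open ≡-Reasoning

    scattered-or-pile : (∀ q → D q ≤ 1) ⊎ ∃₂ λ x R → D ≗ ⟨ x ∷ x ∷ R ⟩ × 2 + length R ≡ size vs D
    scattered-or-pile {D} with All.all? (λ q → D q ≤? 1) vs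
    ... | yes scattered = inj₁ (λ q → All.lookup scattered (vs-complete q))
    ... | no ¬scattered with satisfied (All.¬All⇒Any¬ (λ q → D q ≤? 1) vs ¬scattered)
    ...   | x , Dx≰1 with extract-pile {x} {pebbles D vs} (subst (2 ≤_) (sym (⟨pebbles⟩ x)) (≰⇒> Dx≰1))
    ...     | R , L↭xxR = inj₂ (x , R , (λ q → trans (sym (⟨pebbles⟩ q)) (count-↭ L↭xxR)) ,
                               trans (sym (↭-length L↭xxR)) (length-pebbles vs))

    ¬Solvable-if-piles-safe :
      size vs D < length vs →
      (∀ x R → D ≗ ⟨ x ∷ x ∷ R ⟩ → 2 + length R ≡ size vs D → ∃ λ t → Safe t ⟨ x ∷ x ∷ R ⟩) →
      ¬ Solvable E D
    ¬Solvable-if-piles-safe {D} small piles-safe with scattered-or-pile {D}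
    ... | inj₁ scattered = let t , empty = unoccupied vs small in Safe⇒¬Solvable (safe-frozen empty scattered)
    ... | inj₂ (x , R , D≗ , size≡) =
      let t , s = piles-safe x R D≗ size≡ in Safe⇒¬Solvable (Safe-≤ᴰ (≤-reflexive ∘ D≗) s)

    module _ (far-xxx : ∀ x → ∃ λ t → OutOfReach-xxx t x)
             (far-xxa : ∀ x a → a ≢ x → ∃ λ t → OutOfReach-xxa t x a) where

      safe-pile+1 : ∀ x R → length R ≤ 1 → ∃ λ t → Safe t ⟨ x ∷ x ∷ R ⟩
      safe-pile+1 x [] _ = let t , far = far-xxx x in t , safe-xx far
      safe-pile+1 x (a ∷ []) _ with a ≟ x
      ... | yes refl = let t , far = far-xxx x in t , safe-xxx far
      ... | no a≢x   = let t , far = far-xxa x a a≢x in t , safe-xxa a≢x far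
      safe-pile+1 x (_ ∷ _ ∷ _) (s≤s ())

      size≥4 : 4 ≤ length vs → Solvable E D → 4 ≤ size vs D
      size≥4 4≤|vs| solvable = ≮⇒≥ λ size<4 →
        ¬Solvable-if-piles-safe (≤-trans size<4 4≤|vs|)
          (λ x R _ size≡ → safe-pile+1 x R (≤-pred (≤-pred (≤-pred (subst (_< 4) (sym size≡) size<4)))))
          solvable

      module _ (far-xxab : ∀ x a b → a ≢ x → b ≢ x → b ≢ a → ∃ λ t → OutOfReach-xxab t x a b)
               (far-xxyy : ∀ x y → y ≢ x → ∃ λ t → OutOfReach-xxyy t x y) where

        safe-pile+2 : ∀ x R → count x R ≡ 0 → length R ≤ 2 → ∃ λ t → Safe t ⟨ x ∷ x ∷ R ⟩
        safe-pile+2 x [] _ _ = let t , far = far-xxx x in t , safe-xx far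
        safe-pile+2 x (a ∷ []) x∉R _ with count≡0⇒∉ (a ∷ []) x∉R
        ... | a≢x ∷ [] = let t , far = far-xxa x a a≢x in t , safe-xxa a≢x far
        safe-pile+2 x (a ∷ b ∷ []) x∉R _ with count≡0⇒∉ (a ∷ b ∷ []) x∉R | a ≟ b
        ... | a≢x ∷ _ | yes refl = let t , far = far-xxyy x a a≢x in t , safe-xxyy a≢x far
        ... | a≢x ∷ b≢x ∷ [] | no a≢b =
          let t , far = far-xxab x a b a≢x b≢x (a≢b ∘ sym) in t , safe-xxab a≢x b≢x (a≢b ∘ sym) far
        safe-pile+2 x (_ ∷ _ ∷ _ ∷ _) _ (s≤s (s≤s ()))

        size≥5 : 5 ≤ length vs → TwoRestricted D → Solvable E D → 5 ≤ size vs D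
        size≥5 {D} 5≤|vs| two-restricted solvable = ≮⇒≥ λ size<5 →
          ¬Solvable-if-piles-safe (≤-trans size<5 5≤|vs|)
            (λ x R D≗ size≡ →
              safe-pile+2 x R
                (n≤0⇒n≡0 (+-cancelˡ-≤ 2 _ _ (subst (_≤ 2) (trans (D≗ x) (count-pile x R)) (two-restricted x))))
                (≤-pred (≤-pred (≤-pred (subst (_< 5) (sym size≡) size<5)))))
            solvable

T-all : ∀ {A : Set} (f : A → Bool) {xs x} → T (all f xs) → x ∈ xs → T (f x)
T-all f {xs} holds x∈xs = All.lookup (All.all⁺ f xs holds) x∈xs

T-not : ∀ {b} → T (not b) → ¬ T b
T-not {false} _ ()

modus-ponens : ∀ {a b} → T (not a ∨ b) → T a → T b
modus-ponens {true} b _ = b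

xor-self : ∀ o → T (not (o xor o))
xor-self true  = _
xor-self false = _

xor-sound : ∀ o o' → T (not (o xor o')) → o ≡ o'
xor-sound true  true  _ = refl
xor-sound false false _ = refl

≡ᵇ-sym : ∀ a b → (a ≡ᵇ b) ≡ (b ≡ᵇ a)
≡ᵇ-sym zero    zero    = refl
≡ᵇ-sym zero    (suc b) = refl
≡ᵇ-sym (suc a) zero    = refl
≡ᵇ-sym (suc a) (suc b) = ≡ᵇ-sym a b

%2-dichotomy : ∀ n → n % 2 ≡ 0 ⊎ n % 2 ≡ 1
%2-dichotomy zero = inj₁ refl
%2-dichotomy (suc zero) = inj₂ refl
%2-dichotomy (suc (suc n)) = %2-dichotomy n

halves-injective : ∀ a b → a % 2 ≡ b % 2 → ⌊ a /2⌋ ≡ ⌊ b /2⌋ → a ≡ b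
halves-injective zero zero _ _ = refl
halves-injective (suc zero) (suc zero) _ _ = refl
halves-injective (suc (suc a)) (suc (suc b)) p h = cong (suc ∘ suc) (halves-injective a b p (suc-injective h))
halves-injective zero (suc zero) () _
halves-injective (suc zero) zero () _
halves-injective zero (suc (suc b)) _ ()
halves-injective (suc zero) (suc (suc b)) _ ()
halves-injective (suc (suc a)) zero _ ()
halves-injective (suc (suc a)) (suc zero) _ ()

⌊suc/2⌋-even : ∀ a → a % 2 ≡ 0 → ⌊ suc a /2⌋ ≡ ⌊ a /2⌋
⌊suc/2⌋-even zero _ = refl
⌊suc/2⌋-even (suc (suc a)) p = cong suc (⌊suc/2⌋-even a p)

suc-even-odd : ∀ a → a % 2 ≡ 0 → suc a % 2 ≡ 1
suc-even-odd zero _ = refl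
suc-even-odd (suc (suc a)) p = suc-even-odd a p

halves-bound : ∀ n m → n < m → m % 2 ≡ 0 → suc (⌊ n /2⌋ * 2) < m
halves-bound zero (suc zero) _ ()
halves-bound zero (suc (suc m)) _ _ = s≤s (s≤s z≤n)
halves-bound (suc zero) (suc (suc m)) _ _ = s≤s (s≤s z≤n)
halves-bound (suc (suc n)) (suc (suc m)) (s≤s (s≤s n<m)) even = s≤s (s≤s (halves-bound n m n<m even))

module BlockStructure (m : ℕ) where

  data Side : Set where
    uSide vSide : Side

  -- rim σ o is the kind of u_i (σ = uSide) or v_i (σ = vSide) where o says whether the paper's i = k + 1 is odd.
  data Kind : Set where
    hub : Kind
    rim : Side → Bool → Kind

  oddI : Fin m → Bool
  oddI k = toℕ k % 2 ≡ᵇ 0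

  kind : HV m → Kind
  kind (u k) = rim uSide (oddI k)
  kind (v k) = rim vSide (oddI k)
  kind w = hub

  -- The blocks are the removed pairs {i, i+1}; the block of w is arbitrary.
  block : HV m → ℕ
  block (u k) = ⌊ toℕ k /2⌋
  block (v k) = ⌊ toℕ k /2⌋
  block w = 0

  sameBlockᵇ : HV m → HV m → Bool
  sameBlockᵇ p q = block p ≡ᵇ block q

  adjacentᵏ : Kind → Kind → Bool → Bool
  adjacentᵏ hub hub _ = false
  adjacentᵏ hub (rim _ o) _ = o
  adjacentᵏ (rim _ o) hub _ = o
  adjacentᵏ (rim uSide _) (rim uSide _) same = not same
  adjacentᵏ (rim vSide _) (rim vSide _) same = not same
  adjacentᵏ (rim _ o) (rim _ o') same = not o ∧ not o' ∧ same

  sameSideᵇ : Side → Side → Bool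
  sameSideᵇ uSide uSide = true
  sameSideᵇ vSide vSide = true
  sameSideᵇ _ _ = false

  equalᵏ : Kind → Kind → Bool → Bool
  equalᵏ hub hub _ = true
  equalᵏ (rim σ o) (rim σ' o') same = sameSideᵇ σ σ' ∧ not (o xor o') ∧ same
  equalᵏ _ _ _ = false

  adjacentᵇ equalᵇ : HV m → HV m → Bool
  adjacentᵇ p q = adjacentᵏ (kind p) (kind q) (sameBlockᵇ p q)
  equalᵇ p q = equalᵏ (kind p) (kind q) (sameBlockᵇ p q)

  OddI⇒oddI : ∀ {k} → OddI k → oddI k ≡ true
  OddI⇒oddI odd rewrite odd = refl

  EvenI⇒oddI : ∀ {k} → EvenI k → oddI k ≡ false
  EvenI⇒oddI even rewrite even = refl

  oddI-injective : ∀ (a b : Fin m) → oddI a ≡ oddI b → toℕ a % 2 ≡ toℕ b % 2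
  oddI-injective a b eq with %2-dichotomy (toℕ a) | %2-dichotomy (toℕ b)
  ... | inj₁ a0 | inj₁ b0 = trans a0 (sym b0)
  ... | inj₂ a1 | inj₂ b1 = trans a1 (sym b1)
  ... | inj₁ a0 | inj₂ b1 = contradiction (trans (sym (OddI⇒oddI {a} a0)) (trans eq (EvenI⇒oddI {b} b1))) λ ()
  ... | inj₂ a1 | inj₁ b0 = contradiction (trans (sym (EvenI⇒oddI {a} a1)) (trans eq (OddI⇒oddI {b} b0))) λ ()

  Removed⇒sameBlock : ∀ (a b : Fin m) → Removed a b → ⌊ toℕ a /2⌋ ≡ ⌊ toℕ b /2⌋
  Removed⇒sameBlock a b (inj₁ (odd , b≡1+a)) = sym (trans (cong ⌊_/2⌋ b≡1+a) (⌊suc/2⌋-even (toℕ a) odd))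
  Removed⇒sameBlock a b (inj₂ (odd , a≡1+b)) = trans (cong ⌊_/2⌋ a≡1+b) (⌊suc/2⌋-even (toℕ b) odd)

  sameBlock⇒Removed : ∀ (a b : Fin m) → a ≢ b → ⌊ toℕ a /2⌋ ≡ ⌊ toℕ b /2⌋ → Removed a b
  sameBlock⇒Removed a b a≢b same with %2-dichotomy (toℕ a) | %2-dichotomy (toℕ b)
  ... | inj₁ a0 | inj₁ b0 = contradiction (toℕ-injective (halves-injective _ _ (trans a0 (sym b0)) same)) a≢b
  ... | inj₂ a1 | inj₂ b1 = contradiction (toℕ-injective (halves-injective _ _ (trans a1 (sym b1)) same)) a≢b
  ... | inj₁ a0 | inj₂ b1 =
    inj₁ (a0 , sym (halves-injective _ _ (trans (suc-even-odd (toℕ a) a0) (sym b1))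
                                         (trans (⌊suc/2⌋-even (toℕ a) a0) same)))
  ... | inj₂ a1 | inj₁ b0 =
    inj₂ (b0 , sym (halves-injective _ _ (trans (suc-even-odd (toℕ b) b0) (sym a1))
                                         (trans (⌊suc/2⌋-even (toℕ b) b0) (sym same))))

  sameBlockᵇ-refl : ∀ p → T (sameBlockᵇ p p)
  sameBlockᵇ-refl p = ≡⇒≡ᵇ (block p) (block p) refl

  ≢⇒¬sameBlockᵇ : ∀ p q → block p ≢ block q → T (not (sameBlockᵇ p q))
  ≢⇒¬sameBlockᵇ p q differ with block p ≡ᵇ block q in eq
  ... | false = _
  ... | true  = differ (≡ᵇ⇒≡ (block p) (block q) (subst T (sym eq) _))

  adjacentᵇ-complete : ∀ p q → HAdj m p q → T (adjacentᵇ p q)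
  adjacentᵇ-complete (u a) (u b) (a≢b , ¬removed) =
    ≢⇒¬sameBlockᵇ (u a) (u b) (¬removed ∘ sameBlock⇒Removed a b a≢b)
  adjacentᵇ-complete (v a) (v b) (a≢b , ¬removed) =
    ≢⇒¬sameBlockᵇ (v a) (v b) (¬removed ∘ sameBlock⇒Removed a b a≢b)
  adjacentᵇ-complete (u a) (v a) (refl , even) rewrite EvenI⇒oddI {a} even = sameBlockᵇ-refl (u a)
  adjacentᵇ-complete (v a) (u a) (refl , even) rewrite EvenI⇒oddI {a} even = sameBlockᵇ-refl (u a)
  adjacentᵇ-complete w (u b) odd rewrite OddI⇒oddI {b} odd = _
  adjacentᵇ-complete w (v b) odd rewrite OddI⇒oddI {b} odd = _
  adjacentᵇ-complete (u a) w odd rewrite OddI⇒oddI {a} odd = _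
  adjacentᵇ-complete (v a) w odd rewrite OddI⇒oddI {a} odd = _

  equalᵇ-refl : ∀ p → T (equalᵇ p p)
  equalᵇ-refl (u a) = Equivalence.from T-∧ (xor-self (oddI a) , sameBlockᵇ-refl (u a))
  equalᵇ-refl (v a) = Equivalence.from T-∧ (xor-self (oddI a) , sameBlockᵇ-refl (v a))
  equalᵇ-refl w = _

  same-index : ∀ a b → T (not (oddI a xor oddI b) ∧ (⌊ toℕ a /2⌋ ≡ᵇ ⌊ toℕ b /2⌋)) → a ≡ b
  same-index a b eq with Equivalence.to T-∧ eq
  ... | same-parity , same-block =
    toℕ-injective (halves-injective (toℕ a) (toℕ b) (oddI-injective a b (xor-sound (oddI a) (oddI b) same-parity))
                                                    (≡ᵇ⇒≡ _ _ same-block))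

  equalᵇ-sound : ∀ p q → T (equalᵇ p q) → p ≡ q
  equalᵇ-sound (u a) (u b) eq = cong u (same-index a b eq)
  equalᵇ-sound (v a) (v b) eq = cong v (same-index a b eq)
  equalᵇ-sound w w _ = refl

  index : Bool → ℕ → ℕ
  index true  j = j * 2
  index false j = suc (j * 2)

  index-oddI : ∀ o j → (index o j % 2 ≡ᵇ 0) ≡ o
  index-oddI true  zero    = refl
  index-oddI false zero    = refl
  index-oddI true  (suc j) = index-oddI true j
  index-oddI false (suc j) = index-oddI false j

  index-block : ∀ o j → ⌊ index o j /2⌋ ≡ j
  index-block true  zero    = refl
  index-block false zero    = refl
  index-block true  (suc j) = cong suc (index-block true j)
  index-block false (suc j) = cong suc (index-block false j)

  index<m : ∀ o j → suc (j * 2) < m → index o j < m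
  index<m true  j bound = ≤-trans (n≤1+n _) bound
  index<m false j bound = bound

  onSide : Side → Fin m → HV m
  onSide uSide = u
  onSide vSide = v

  vertexAt : Side → Bool → (j : ℕ) → suc (j * 2) < m → HV m
  vertexAt σ o j bound = onSide σ (fromℕ< (index<m o j bound))

  kind-vertexAt : ∀ σ o j bound → kind (vertexAt σ o j bound) ≡ rim σ o
  kind-vertexAt σ o j bound = lemma σ
    where
    oddI-at : oddI (fromℕ< (index<m o j bound)) ≡ o
    oddI-at = trans (cong (λ n → n % 2 ≡ᵇ 0) (toℕ-fromℕ< (index<m o j bound))) (index-oddI o j)
    lemma : ∀ σ → kind (onSide σ (fromℕ< (index<m o j bound))) ≡ rim σ o
    lemma uSide = cong (rim uSide) oddI-at
    lemma vSide = cong (rim vSide) oddI-at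

  block-vertexAt : ∀ σ o j bound → block (vertexAt σ o j bound) ≡ j
  block-vertexAt uSide o j bound = trans (cong ⌊_/2⌋ (toℕ-fromℕ< (index<m o j bound))) (index-block o j)
  block-vertexAt vSide o j bound = trans (cong ⌊_/2⌋ (toℕ-fromℕ< (index<m o j bound))) (index-block o j)

  infixr 3 _∧ᶠ_
  infixr 2 _≉_⇒_ _∼_⇒_ ∀ᶠ_ ∃ᶠ_
  infix 4 _≉_ _≁_

  -- Variables are de Bruijn indices: # 0 is the innermost bound vertex.
  data Formula (n : ℕ) : Set where
    _≉_ _≁_ : Fin n → Fin n → Formula n
    _∧ᶠ_ : Formula n → Formula n → Formula n
    _≉_⇒_ _∼_⇒_ : Fin n → Fin n → Formula n → Formula n
    ∀ᶠ_ ∃ᶠ_ : Formula (suc n) → Formula n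

  ⟦_⟧ : ∀ {n} → Formula n → Vec (HV m) n → Set
  ⟦ i ≉ j ⟧ ρ = lookup ρ i ≢ lookup ρ j
  ⟦ i ≁ j ⟧ ρ = ¬ HAdj m (lookup ρ i) (lookup ρ j)
  ⟦ φ ∧ᶠ ψ ⟧ ρ = ⟦ φ ⟧ ρ × ⟦ ψ ⟧ ρ
  ⟦ i ≉ j ⇒ φ ⟧ ρ = lookup ρ i ≢ lookup ρ j → ⟦ φ ⟧ ρ
  ⟦ i ∼ j ⇒ φ ⟧ ρ = HAdj m (lookup ρ i) (lookup ρ j) → ⟦ φ ⟧ ρ
  ⟦ ∀ᶠ φ ⟧ ρ = (p : HV m) → ⟦ φ ⟧ (p ∷ ρ)
  ⟦ ∃ᶠ φ ⟧ ρ = Σ (HV m) λ p → ⟦ φ ⟧ (p ∷ ρ)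

  -- The profile of p₀ … pₙ₋₁ records each kind and which later pⱼ share a block with pᵢ.
  data Profile : ℕ → Set where
    ∅ : Profile 0
    _▸_ : ∀ {n} → Kind × Vec Bool n → Profile n → Profile (suc n)

  blocksOf : ∀ {n} → HV m → Vec (HV m) n → Vec Bool n
  blocksOf p = Vec.map (sameBlockᵇ p)

  profile : ∀ {n} → Vec (HV m) n → Profile n
  profile [] = ∅
  profile (p ∷ ρ) = (kind p , blocksOf p ρ) ▸ profile ρ

  kindAt : ∀ {n} → Profile n → Fin n → Kind
  kindAt ((κ , _) ▸ _) fzero = κ
  kindAt (_ ▸ P) (fsuc i) = kindAt P i

  linked : ∀ {n} → Profile n → Fin n → Fin n → Bool
  linked _ fzero fzero = true
  linked ((_ , c) ▸ _) fzero (fsuc j) = lookup c j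
  linked ((_ , c) ▸ _) (fsuc i) fzero = lookup c i
  linked (_ ▸ P) (fsuc i) (fsuc j) = linked P i j

  atom : ∀ {n} → (Kind → Kind → Bool → Bool) → Profile n → Fin n → Fin n → Bool
  atom f P i j = f (kindAt P i) (kindAt P j) (linked P i j)

  agree disjoint : ∀ {n} → Vec Bool n → Vec Bool n → Bool
  agree [] [] = true
  agree (x ∷ c) (y ∷ b) = not (x xor y) ∧ agree c b
  disjoint [] [] = true
  disjoint (x ∷ c) (y ∷ b) = not (x ∧ y) ∧ disjoint c b

  -- A necessary condition for b to be blocksOf p ρ when P is the profile of ρ: block equality is transitive.
  consistent : ∀ {n} → Profile n → Vec Bool n → Bool
  consistent ∅ [] = true
  consistent ((_ , c) ▸ P) (β ∷ b) = (if β then agree c b else disjoint c b) ∧ consistent P b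

  allBits : ∀ n → List (Vec Bool n)
  allBits zero = [] ∷ []
  allBits (suc n) = List.map (true ∷_) (allBits n) ++ List.map (false ∷_) (allBits n)

  kinds : List Kind
  kinds = hub ∷ rim uSide true ∷ rim uSide false ∷ rim vSide true ∷ rim vSide false ∷ []

  -- Descriptions of existential witnesses: w, or a vertex of the given kind in the block of
  -- the i-th vertex in scope, or in a block other than that one.
  data Witness (n : ℕ) : Set where
    centre : Witness n
    beside awayFrom : Side → Bool → Fin n → Witness n

  witnesses : ∀ n → List (Witness n)
  witnesses n = centre ∷ concatMap candidates (allFin n)
    where
    candidates : Fin n → List (Witness n)
    candidates i = concatMap (λ σ → concatMap (λ o → beside σ o i ∷ awayFrom σ o i ∷ []) (true ∷ false ∷ []))
                             (uSide ∷ vSide ∷ [])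

  kindOf : ∀ {n} → Witness n → Kind
  kindOf centre = hub
  kindOf (beside σ o _) = rim σ o
  kindOf (awayFrom σ o _) = rim σ o

  admissible : ∀ {n} → Witness n → Profile n → Vec Bool n → Bool
  admissible centre P b = consistent P b
  admissible (beside _ _ i) P b = consistent P b ∧ lookup b i
  admissible (awayFrom _ _ i) P b = consistent P b ∧ not (lookup b i)

  ⟦_⟧ᵇ : ∀ {n} → Formula n → Profile n → Bool
  ⟦ i ≉ j ⟧ᵇ P = not (atom equalᵏ P i j)
  ⟦ i ≁ j ⟧ᵇ P = not (atom adjacentᵏ P i j)
  ⟦ φ ∧ᶠ ψ ⟧ᵇ P = ⟦ φ ⟧ᵇ P ∧ ⟦ ψ ⟧ᵇ P
  ⟦ i ≉ j ⇒ φ ⟧ᵇ P = atom equalᵏ P i j ∨ ⟦ φ ⟧ᵇ P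
  ⟦ i ∼ j ⇒ φ ⟧ᵇ P = not (atom adjacentᵏ P i j) ∨ ⟦ φ ⟧ᵇ P
  ⟦ ∀ᶠ φ ⟧ᵇ P =
    all (λ κ → all (λ b → not (consistent P b) ∨ ⟦ φ ⟧ᵇ ((κ , b) ▸ P)) (allBits _)) kinds
  ⟦ ∃ᶠ φ ⟧ᵇ P =
    any (λ d → all (λ b → not (admissible d P b) ∨ ⟦ φ ⟧ᵇ ((kindOf d , b) ▸ P)) (allBits _)) (witnesses _)

  ∈-kinds : ∀ κ → κ ∈ kinds
  ∈-kinds hub = here refl
  ∈-kinds (rim uSide true) = there (here refl)
  ∈-kinds (rim uSide false) = there (there (here refl))
  ∈-kinds (rim vSide true) = there (there (there (here refl)))
  ∈-kinds (rim vSide false) = there (there (there (there (here refl))))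

  ∈-allBits : ∀ {n} (b : Vec Bool n) → b ∈ allBits n
  ∈-allBits [] = here refl
  ∈-allBits {suc n} (true ∷ b) = ∈-++⁺ˡ (∈-map⁺ (true ∷_) (∈-allBits b))
  ∈-allBits {suc n} (false ∷ b) = ∈-++⁺ʳ (List.map (true ∷_) (allBits n)) (∈-map⁺ (false ∷_) (∈-allBits b))

  kindAt-profile : ∀ {n} (ρ : Vec (HV m) n) i → kindAt (profile ρ) i ≡ kind (lookup ρ i)
  kindAt-profile (p ∷ ρ) fzero = refl
  kindAt-profile (p ∷ ρ) (fsuc i) = kindAt-profile ρ i

  linked-profile : ∀ {n} (ρ : Vec (HV m) n) i j → linked (profile ρ) i j ≡ sameBlockᵇ (lookup ρ i) (lookup ρ j)
  linked-profile (p ∷ ρ) fzero fzero = sym (Equivalence.to T-≡ (sameBlockᵇ-refl p))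
  linked-profile (p ∷ ρ) fzero (fsuc j) = lookup-map j (sameBlockᵇ p) ρ
  linked-profile (p ∷ ρ) (fsuc i) fzero =
    trans (lookup-map i (sameBlockᵇ p) ρ) (≡ᵇ-sym (block p) (block (lookup ρ i)))
  linked-profile (p ∷ ρ) (fsuc i) (fsuc j) = linked-profile ρ i j

  atom-profile : ∀ {n} f (ρ : Vec (HV m) n) i j →
                 atom f (profile ρ) i j ≡
                 f (kind (lookup ρ i)) (kind (lookup ρ j)) (sameBlockᵇ (lookup ρ i) (lookup ρ j))
  atom-profile f ρ i j rewrite kindAt-profile ρ i | kindAt-profile ρ j | linked-profile ρ i j = refl

  agree-refl : ∀ {n} (c : Vec Bool n) → T (agree c c)
  agree-refl [] = _
  agree-refl (x ∷ c) = Equivalence.from T-∧ (xor-self x , agree-refl c)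

  blocksOf-cong : ∀ {n} p q (ρ : Vec (HV m) n) → block p ≡ block q → blocksOf p ρ ≡ blocksOf q ρ
  blocksOf-cong p q [] _ = refl
  blocksOf-cong p q (r ∷ ρ) eq = cong₂ _∷_ (cong (_≡ᵇ block r) eq) (blocksOf-cong p q ρ eq)

  disjoint-blocks : ∀ {n} p q (ρ : Vec (HV m) n) → block q ≢ block p → T (disjoint (blocksOf p ρ) (blocksOf q ρ))
  disjoint-blocks p q [] _ = _
  disjoint-blocks p q (r ∷ ρ) differ = Equivalence.from T-∧ (apart , disjoint-blocks p q ρ differ)
    where
    apart : T (not (sameBlockᵇ p r ∧ sameBlockᵇ q r))
    apart with block p ≡ᵇ block r in pr | block q ≡ᵇ block r in qr
    ... | false | _     = _
    ... | true  | false = _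
    ... | true  | true  = differ (trans (≡ᵇ⇒≡ _ _ (subst T (sym qr) _)) (sym (≡ᵇ⇒≡ _ _ (subst T (sym pr) _))))

  consistent-blocks : ∀ {n} t (ρ : Vec (HV m) n) → T (consistent (profile ρ) (blocksOf t ρ))
  consistent-blocks t [] = _
  consistent-blocks t (p ∷ ρ) = Equivalence.from T-∧ (row , consistent-blocks t ρ)
    where
    row : T (if sameBlockᵇ t p then agree (blocksOf p ρ) (blocksOf t ρ) else disjoint (blocksOf p ρ) (blocksOf t ρ))
    row with block t ≡ᵇ block p in tp
    ... | true  = subst (T ∘ agree (blocksOf p ρ)) (blocksOf-cong p t ρ (sym (≡ᵇ⇒≡ _ _ (subst T (sym tp) _))))
                        (agree-refl (blocksOf p ρ))
    ... | false = disjoint-blocks p t ρ λ eq → subst T tp (≡⇒≡ᵇ _ _ eq)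

  module Soundness (4≤m : 4 ≤ m) (m-even : m % 2 ≡ 0) where

    blockBound : ∀ p → suc (block p * 2) < m
    blockBound (u k) = halves-bound (toℕ k) m (toℕ<n k) m-even
    blockBound (v k) = halves-bound (toℕ k) m (toℕ<n k) m-even
    blockBound w = ≤-trans (s≤s (s≤s z≤n)) 4≤m

    otherBlock : ℕ → ℕ
    otherBlock zero = 1
    otherBlock (suc _) = 0

    otherBlock-bound : ∀ j → suc (otherBlock j * 2) < m
    otherBlock-bound zero = 4≤m
    otherBlock-bound (suc _) = ≤-trans (s≤s (s≤s z≤n)) 4≤m

    otherBlock-≢ : ∀ j → otherBlock j ≢ j
    otherBlock-≢ zero ()
    otherBlock-≢ (suc _) ()

    realize : ∀ {n} → Witness n → Vec (HV m) n → HV m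
    realize centre ρ = w
    realize (beside σ o i) ρ = vertexAt σ o (block (lookup ρ i)) (blockBound (lookup ρ i))
    realize (awayFrom σ o i) ρ = vertexAt σ o (otherBlock (block (lookup ρ i))) (otherBlock-bound (block (lookup ρ i)))

    kind-realize : ∀ {n} (d : Witness n) ρ → kind (realize d ρ) ≡ kindOf d
    kind-realize centre ρ = refl
    kind-realize (beside σ o i) ρ = kind-vertexAt σ o _ (blockBound (lookup ρ i))
    kind-realize (awayFrom σ o i) ρ = kind-vertexAt σ o _ (otherBlock-bound (block (lookup ρ i)))

    admissible-realize : ∀ {n} (d : Witness n) ρ → T (admissible d (profile ρ) (blocksOf (realize d ρ) ρ))
    admissible-realize centre ρ = consistent-blocks w ρ
    admissible-realize (beside σ o i) ρ =
      Equivalence.from T-∧ (consistent-blocks r ρ ,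
        subst T (sym (lookup-map i (sameBlockᵇ r) ρ))
                (≡⇒≡ᵇ (block r) _ (block-vertexAt σ o _ (blockBound (lookup ρ i)))))
      where r = realize (beside σ o i) ρ
    admissible-realize (awayFrom σ o i) ρ =
      Equivalence.from T-∧ (consistent-blocks r ρ ,
        subst (T ∘ not) (sym (lookup-map i (sameBlockᵇ r) ρ))
              (≢⇒¬sameBlockᵇ r (lookup ρ i) λ eq →
                 otherBlock-≢ j (trans (sym (block-vertexAt σ o _ (otherBlock-bound j))) eq)))
      where j = block (lookup ρ i)
            r = realize (awayFrom σ o i) ρ

    sound : ∀ {n} (φ : Formula n) ρ → T (⟦ φ ⟧ᵇ (profile ρ)) → ⟦ φ ⟧ ρ
    sound (i ≉ j) ρ holds equal =
      T-not (subst (T ∘ not) (atom-profile equalᵏ ρ i j) holds)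
            (subst (λ q → T (equalᵇ (lookup ρ i) q)) equal (equalᵇ-refl (lookup ρ i)))
    sound (i ≁ j) ρ holds adjacent =
      T-not (subst (T ∘ not) (atom-profile adjacentᵏ ρ i j) holds) (adjacentᵇ-complete _ _ adjacent)
    sound (φ ∧ᶠ ψ) ρ holds with Equivalence.to T-∧ holds
    ... | φ-holds , ψ-holds = sound φ ρ φ-holds , sound ψ ρ ψ-holds
    sound (i ≉ j ⇒ φ) ρ holds distinct with Equivalence.to T-∨ holds
    ... | inj₁ equal   = ⊥-elim (distinct (equalᵇ-sound _ _ (subst T (atom-profile equalᵏ ρ i j) equal)))
    ... | inj₂ φ-holds = sound φ ρ φ-holds
    sound (i ∼ j ⇒ φ) ρ holds adjacent =
      sound φ ρ (modus-ponens holds (subst T (sym (atom-profile adjacentᵏ ρ i j)) (adjacentᵇ-complete _ _ adjacent)))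
    sound (∀ᶠ φ) ρ holds p =
      sound φ (p ∷ ρ)
        (modus-ponens (T-all (body (kind p)) (T-all (λ κ → all (body κ) (allBits _)) holds (∈-kinds (kind p)))
                                             (∈-allBits (blocksOf p ρ)))
                      (consistent-blocks p ρ))
      where
      body : Kind → Vec Bool _ → Bool
      body κ b = not (consistent (profile ρ) b) ∨ ⟦ φ ⟧ᵇ ((κ , b) ▸ profile ρ)
    sound (∃ᶠ φ) ρ holds with satisfied (any⁻ _ (witnesses _) holds)
    ... | d , d-works =
      realize d ρ ,
      sound φ (realize d ρ ∷ ρ)
        (subst (λ κ → T (⟦ φ ⟧ᵇ ((κ , blocksOf (realize d ρ) ρ) ▸ profile ρ))) (sym (kind-realize d ρ))
               (modus-ponens (T-all body d-works (∈-allBits (blocksOf (realize d ρ) ρ))) (admissible-realize d ρ)))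
      where
      body : Vec Bool _ → Bool
      body b = not (admissible d (profile ρ) b) ∨ ⟦ φ ⟧ᵇ ((kindOf d , b) ▸ profile ρ)

module OptimalPebbling (k : ℕ) (m-even : (4 + k) % 2 ≡ 0) where

  m : ℕ
  m = 4 + k

  _≟ᴴ_ : DecidableEquality (HV m)
  u a ≟ᴴ u b with a Fin.≟ b
  ... | yes refl = yes refl
  ... | no a≢b   = no λ { refl → a≢b refl }
  v a ≟ᴴ v b with a Fin.≟ b
  ... | yes refl = yes refl
  ... | no a≢b   = no λ { refl → a≢b refl }
  w ≟ᴴ w = yes refl
  u _ ≟ᴴ v _ = no λ ()
  u _ ≟ᴴ w   = no λ ()
  v _ ≟ᴴ u _ = no λ ()
  v _ ≟ᴴ w   = no λ ()
  w ≟ᴴ u _   = no λ ()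
  w ≟ᴴ v _   = no λ ()

  HAdj-irrefl : ∀ {p} → ¬ HAdj m p p
  HAdj-irrefl {u _} (a≢a , _) = a≢a refl
  HAdj-irrefl {v _} (a≢a , _) = a≢a refl
  HAdj-irrefl {w} ()

  vertices-unique : Unique (vertices m)
  vertices-unique =
    All.++⁺ (All.map⁺ (All.universal (λ _ ()) (allFin m))) (All.map⁺ (All.universal (λ _ ()) (allFin m))) ∷
    Unique.++⁺ (Unique.map⁺ u-injective (Unique.allFin⁺ m)) (Unique.map⁺ v-injective (Unique.allFin⁺ m)) u≢v
    where
    u-injective : ∀ {a b} → u {m} a ≡ u b → a ≡ b
    u-injective refl = refl
    v-injective : ∀ {a b} → v {m} a ≡ v b → a ≡ b
    v-injective refl = refl
    u≢v : ∀ {p} → ¬ (p ∈ List.map u (allFin m) × p ∈ List.map v (allFin m))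
    u≢v (p∈us , p∈vs) with ∈-map⁻ u p∈us | ∈-map⁻ v p∈vs
    ... | _ , _ , refl | _ , _ , ()

  vertices-complete : ∀ p → p ∈ vertices m
  vertices-complete (u a) = there (∈-++⁺ˡ (∈-map⁺ u (∈-allFin a)))
  vertices-complete (v a) = there (∈-++⁺ʳ (List.map u (allFin m)) (∈-map⁺ v (∈-allFin a)))
  vertices-complete w = here refl

  5≤|vertices| : 5 ≤ length (vertices m)
  5≤|vertices| = s≤s (s≤s (s≤s (s≤s (s≤s z≤n))))

  open Pebbling _≟ᴴ_ (HAdj m) HAdj-irrefl
  open Enumerated (vertices m) vertices-unique vertices-complete
  open BlockStructure m
  open Soundness (s≤s (s≤s (s≤s (s≤s z≤n)))) m-even

  far-xxx : ∀ x → ∃ λ t → OutOfReach-xxx t x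
  far-xxx = sound (∀ᶠ ∃ᶠ # 0 ≉ # 1 ∧ᶠ # 1 ≁ # 0) [] _

  far-xxa : ∀ x a → a ≢ x → ∃ λ t → OutOfReach-xxa t x a
  far-xxa = sound (∀ᶠ ∀ᶠ # 0 ≉ # 1 ⇒ ∃ᶠ
                     # 0 ≉ # 2 ∧ᶠ # 0 ≉ # 1 ∧ᶠ # 2 ≁ # 0 ∧ᶠ (# 2 ∼ # 1 ⇒ # 1 ≁ # 0)) [] _

  far-xxab : ∀ x a b → a ≢ x → b ≢ x → b ≢ a → ∃ λ t → OutOfReach-xxab t x a b
  far-xxab = sound (∀ᶠ ∀ᶠ ∀ᶠ # 1 ≉ # 2 ⇒ # 0 ≉ # 2 ⇒ # 0 ≉ # 1 ⇒ ∃ᶠ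
                      # 0 ≉ # 3 ∧ᶠ # 0 ≉ # 2 ∧ᶠ # 0 ≉ # 1 ∧ᶠ # 3 ≁ # 0 ∧ᶠ
                      (# 3 ∼ # 2 ⇒ # 2 ≁ # 0 ∧ᶠ (# 2 ∼ # 1 ⇒ # 1 ≁ # 0)) ∧ᶠ
                      (# 3 ∼ # 1 ⇒ # 1 ≁ # 0 ∧ᶠ (# 1 ∼ # 2 ⇒ # 2 ≁ # 0))) [] _

  far-xxyy : ∀ x y → y ≢ x → ∃ λ t → OutOfReach-xxyy t x y
  far-xxyy = sound (∀ᶠ ∀ᶠ # 0 ≉ # 1 ⇒ ∃ᶠ
                      # 0 ≉ # 2 ∧ᶠ # 0 ≉ # 1 ∧ᶠ # 2 ≁ # 0 ∧ᶠ # 1 ≁ # 0 ∧ᶠ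
                      (∀ᶠ # 3 ∼ # 0 ⇒ # 2 ∼ # 0 ⇒ # 0 ≁ # 1)) [] _

  solvable⇒size≥4 : ∀ D → Solvable (HAdj m) D → 4 ≤ size (vertices m) D
  solvable⇒size≥4 _ = size≥4 far-xxx far-xxa (≤-trans (n≤1+n 4) 5≤|vertices|)

  solvable⇒size≥5 : ∀ D → TwoRestricted D → Solvable (HAdj m) D → 5 ≤ size (vertices m) D
  solvable⇒size≥5 _ = size≥5 far-xxx far-xxa far-xxab far-xxyy 5≤|vertices|

  differentBlocks⇒adjacent : ∀ a b → ⌊ toℕ a /2⌋ ≢ ⌊ toℕ b /2⌋ → a ≢ b × ¬ Removed a b
  differentBlocks⇒adjacent a b differ = (λ { refl → differ refl }) , differ ∘ Removed⇒sameBlock a b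

  i₀ i₁ i₂ : Fin m
  i₀ = fzero
  i₁ = fsuc fzero
  i₂ = fsuc (fsuc fzero)

  oddPartner : (a : Fin m) → Σ (Fin m) λ c → OddI c × ⌊ toℕ c /2⌋ ≢ ⌊ toℕ a /2⌋
  oddPartner a with ⌊ toℕ a /2⌋
  ... | zero  = i₂ , refl , λ ()
  ... | suc _ = i₀ , refl , λ ()

  D₄ : Distribution (HV m)
  D₄ = ⟨ w ∷ w ∷ w ∷ w ∷ [] ⟩

  D₄-solvable : Solvable (HAdj m) D₄
  D₄-solvable w = reach-occupied (s≤s z≤n)
  D₄-solvable (u a) with %2-dichotomy (toℕ a) | oddPartner a
  ... | inj₁ odd | _ = reach-adjacent {x = w} odd (s≤s (s≤s z≤n))
  ... | inj₂ _   | c , odd , differ = reach-distance-2 {x = w} {z = u c} ≤-refl odd (differentBlocks⇒adjacent c a differ)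
  D₄-solvable (v a) with %2-dichotomy (toℕ a) | oddPartner a
  ... | inj₁ odd | _ = reach-adjacent {x = w} odd (s≤s (s≤s z≤n))
  ... | inj₂ _   | c , odd , differ = reach-distance-2 {x = w} {z = v c} ≤-refl odd (differentBlocks⇒adjacent c a differ)

  size-D₄ : size (vertices m) D₄ ≡ 4
  size-D₄ = size-⟨⟩ (w ∷ w ∷ w ∷ w ∷ [])

  D₅ : Distribution (HV m)
  D₅ = ⟨ u i₀ ∷ u i₀ ∷ v i₀ ∷ v i₀ ∷ w ∷ [] ⟩

  apart₀₂ : i₀ ≢ i₂ × ¬ Removed i₀ i₂
  apart₀₂ = differentBlocks⇒adjacent i₀ i₂ λ ()

  apart₂₁ : i₂ ≢ i₁ × ¬ Removed i₂ i₁
  apart₂₁ = differentBlocks⇒adjacent i₂ i₁ λ ()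

  D₅-two-restricted : TwoRestricted D₅
  D₅-two-restricted (u fzero)    = ≤-refl
  D₅-two-restricted (u (fsuc _)) = z≤n
  D₅-two-restricted (v fzero)    = ≤-refl
  D₅-two-restricted (v (fsuc _)) = z≤n
  D₅-two-restricted w            = s≤s z≤n

  -- u_2 and v_2 are reached via u_3 resp. v_3, which collects one pebble from u_1 resp. v_1 and one through w.
  D₅-solvable : Solvable (HAdj m) D₅
  D₅-solvable w         = reach-occupied (s≤s z≤n)
  D₅-solvable (u fzero) = reach-occupied (s≤s z≤n)
  D₅-solvable (v fzero) = reach-occupied (s≤s z≤n)
  D₅-solvable (u (fsuc (fsuc a))) = reach-adjacent {x = u i₀} (differentBlocks⇒adjacent i₀ _ λ ()) (s≤s (s≤s z≤n))
  D₅-solvable (v (fsuc (fsuc a))) = reach-adjacent {x = v i₀} (differentBlocks⇒adjacent i₀ _ λ ()) (s≤s (s≤s z≤n))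
  D₅-solvable (u (fsuc fzero)) =
    _ , move {x = u i₀} {y = u i₂} apart₀₂ ≤-refl
      ◅ move {x = v i₀} {y = w} refl ≤-refl
      ◅ move {x = w} {y = u i₂} refl ≤-refl
      ◅ move {x = u i₂} {y = u i₁} apart₂₁ ≤-refl
      ◅ ε
    , s≤s z≤n
  D₅-solvable (v (fsuc fzero)) =
    _ , move {x = v i₀} {y = v i₂} apart₀₂ ≤-refl
      ◅ move {x = u i₀} {y = w} refl ≤-refl
      ◅ move {x = w} {y = v i₂} refl ≤-refl
      ◅ move {x = v i₂} {y = v i₁} apart₂₁ ≤-refl
      ◅ ε
    , s≤s z≤n

  size-D₅ : size (vertices m) D₅ ≡ 5
  size-D₅ = size-⟨⟩ (u i₀ ∷ u i₀ ∷ v i₀ ∷ v i₀ ∷ w ∷ [])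

mainTheorem8 : (m : ℕ) → 4 ≤ m → m % 2 ≡ 0 →
    OptPebbling2Is m 5 × OptPebblingIs m 4
mainTheorem8 (suc (suc (suc (suc k)))) _ m-even =
  ((D₅ , D₅-two-restricted , D₅-solvable , size-D₅) , solvable⇒size≥5) ,
  ((D₄ , D₄-solvable , size-D₄) , solvable⇒size≥4)
  where open OptimalPebbling k m-even
mainTheorem8 (suc (suc zero)) (s≤s (s≤s ())) _
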